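{- Let $p$ be a prime and $m\geq 3$ an integer with $\gcd(p,m)=1$ and $\gcd(p-1,m)=1$. Let $\ell=\min\{e\geq 1:\gcd(p^e-1,m)>1\}$ and $m'=\gcd(p^\ell-1,m)$. Then every integer $n\geq \ell(p-1)$ lies in $W_p(m')$, and $W_p(m')\subseteq W_p(m)$.
   Context: For a prime $p$ and a positive integer $m$, $W_p(m)$ denotes the set of integers $n\geq 0$ for which there exist $\alpha_1,\dots,\alpha_n\in\overline{\mathbb{F}}_p$ with $\alpha_i^m=1$ for all $i$ (repetitions allowed) and $\alpha_1+\cdots+\alpha_n=0$. -}

module Defs where

open import Level using (Level; _⊔_)
open import Data.Nat as ℕ using (ℕ; zero; suc; _∸_; _^_)
open import Data.Nat.GCD using (gcd)
open import Data.Fin using (Fin)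
open import Data.List using (List; []; _∷_)
open import Data.Product using (Σ; ∃; _×_; _,_)
open import Relation.Nullary using (¬_)
open import Algebra.Bundles using (CommutativeRing)

module _ {c ℓ : Level} (R : CommutativeRing c ℓ) where
  open CommutativeRing R

  pow : Carrier → ℕ → Carrier
  pow x zero    = 1#
  pow x (suc k) = x * pow x k

  natCast : ℕ → Carrier
  natCast zero    = 0#
  natCast (suc k) = 1# + natCast k

  sumFin : ∀ {n} → (Fin n → Carrier) → Carrier
  sumFin {zero}  f = 0#
  sumFin {suc n} f = f Fin.zero + sumFin (λ i → f (Fin.suc i))
    where import Data.Fin as Fin

  IsField : Set (c ⊔ ℓ)
  IsField = (¬ (1# ≈ 0#)) × (∀ x → ¬ (x ≈ 0#) → ∃ λ y → x * y ≈ 1#)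

  -- evaluation of the monic polynomial x^d + c_{d-1} x^{d-1} + ... + c_0,
  -- where cs = c_0 ∷ c_1 ∷ ... ∷ c_{d-1} (so d = length cs)
  evalMonic : List Carrier → Carrier → Carrier
  evalMonic []       x = 1#
  evalMonic (a ∷ cs) x = a + x * evalMonic cs x

  IsAlgClosed : Set (c ⊔ ℓ)
  IsAlgClosed = ∀ (a : Carrier) (cs : List Carrier) → ∃ λ x → evalMonic (a ∷ cs) x ≈ 0#

  HasChar : ℕ → Set ℓ
  HasChar p = natCast p ≈ 0#

  -- W(m) computed in R: n ∈ W(m) iff there are α₁..αₙ in R with αᵢ^m = 1 and Σ αᵢ = 0.
  -- With R an algebraic closure of 𝔽_p (any algebraically closed field of char p)
  -- this is W_p(m).
  InW : ℕ → ℕ → Set (c ⊔ ℓ)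
  InW m n = ∃ λ (α : Fin n → Carrier) → (∀ i → pow (α i) m ≈ 1#) × (sumFin α ≈ 0#)

IsLeastOrderIndex : ℕ → ℕ → ℕ → Set
IsLeastOrderIndex p m l =
  (1 ℕ.≤ l) × (1 ℕ.< gcd (p ^ l ∸ 1) m)
  × (∀ e → 1 ℕ.≤ e → 1 ℕ.< gcd (p ^ e ∸ 1) m → l ℕ.≤ e)

{-# OPTIONS --safe #-}
module Submission where

-- Let m′ = gcd (pˡ − 1) m and let ζ ≠ 1 be a root of 1 + x + ⋯ + x^(m′−1), so ζ^m′ = 1.
-- Minimality of l makes the Frobenius orbit ζ, ζᵖ, …, ζ^(p^(l−1)) consist of l distinct
-- elements different from 1, while ζ^(pˡ) = ζ. Hence f = ∏ᵢ (x − ζ^(pⁱ)) is fixed by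
-- Frobenius: f is a monic polynomial of degree l over 𝔽ₚ with f(1) ≠ 0 dividing x^m′ − 1.
-- Conversely, for any such f and any root ξ of f, scale f by u with u·f(1) ≡ n (mod p) and
-- reduce the coefficients of x, …, xˡ mod p; they sum to at most l(p − 1) ≤ n, and the
-- constant coefficient can absorb the rest of n. Taking cᵢ copies of ξⁱ then shows
-- n ∈ W(m′), and W(m′) ⊆ W(m) because m′ ∣ m.
--
-- Constructively, that f has coefficients in 𝔽ₚ only holds up to double negation, since
-- equality in the field is undecidable. The two properties of f used above, however, are
-- decidable for coefficient vectors in 𝔽ₚˡ, so a finite search turns the doubly negated
-- existence into an actual witness.

open import Defs
open import Level using (Level)
open import Function using (_∘_)
open import Function.Definitions using (Injective)
open import Data.Product as Product using (∃; _×_; _,_; proj₁; proj₂)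
open import Data.Sum using (inj₁; inj₂)
open import Relation.Nullary using (¬_; Dec; contradiction)
import Relation.Nullary.Decidable as Dec
open import Relation.Binary.Definitions using (tri<; tri≈; tri>)
open import Relation.Binary.PropositionalEquality as ≡ using (_≡_; _≢_)
open import Data.Nat as ℕ using (ℕ; zero; suc; _∸_; _≤_; _<_; z≤n; s≤s; NonZero; _!)
import Data.Nat.Properties as ℕ
open import Data.Nat.Divisibility
  using (_∣_; _∣?_; divides; ∣⇒≤; m∣m*n; n∣m*n; ∣1⇒≡1; ∣-refl; ∣-trans)
open import Data.Nat.DivMod using (_%_; _/_; m/n*n≡m; m≡m%n+[m/n]*n; m%n<n)
open import Data.Nat.GCD using (gcd; gcd[m,n]∣m; gcd[m,n]∣n; gcd[m,n]≡0⇒n≡0; module Bézout)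
open import Data.Nat.Coprimality using (Coprime; coprime-Bézout; gcd≡1⇒coprime)
open import Data.Nat.Primality using (Prime; euclidsLemma; prime⇒nonZero; prime⇒nonTrivial; prime⇒irreducible)
open import Data.Nat.Combinatorics using (_C_; nCn≡1; nCk≡n!/k![n-k]!; k![n∸k]!∣n!)
open import Data.Integer as ℤ using (ℤ; -[1+_]; _⊖_)
import Data.Integer.Properties as ℤ
open import Data.Maybe as Maybe using (Maybe)
open import Data.Fin as Fin using (Fin; zero; suc; toℕ; fromℕ)
import Data.Fin.Properties as Fin
import Data.List as List
open import Data.Vec as Vec using (Vec; []; _∷_; _∷ʳ_; _++_)
import Data.Vec.Properties as Vec
open import Data.Vec.Relation.Unary.All as All using (All; []; _∷_)
import Data.Vec.Relation.Unary.All.Properties as All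
open import Data.Vec.Relation.Binary.Pointwise.Inductive as Pointwise using (Pointwise; []; _∷_)
open import Data.Vec.Functional using (tail; init)
open import Algebra.Bundles using (CommutativeRing)
import Algebra.Solver.Ring.AlmostCommutativeRing as ACR

sum-map-≤ : ∀ {n k} (f : ℕ → ℕ) → (∀ b → f b ≤ k) → (bs : Vec ℕ n) →
            Vec.sum (Vec.map f bs) ≤ n ℕ.* k
sum-map-≤ f f≤k [] = z≤n
sum-map-≤ f f≤k (b ∷ bs) = ℕ.+-mono-≤ (f≤k b) (sum-map-≤ f f≤k bs)

Pointwise-mapˡ : ∀ {a b c r} {A : Set a} {B : Set b} {C : Set c} {R : C → B → Set r} {n}
                 (f : A → C) {xs : Vec A n} {ys : Vec B n} →
                 Pointwise (λ x y → R (f x) y) xs ys → Pointwise R (Vec.map f xs) ys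
Pointwise-mapˡ f [] = []
Pointwise-mapˡ f (r ∷ rs) = r ∷ Pointwise-mapˡ f rs

Pointwise-map⇒All : ∀ {a r} {A : Set a} {R : A → A → Set r} {n} (f : A → A) (xs : Vec A n) →
                    Pointwise R (Vec.map f xs) xs → All (λ x → R (f x) x) xs
Pointwise-map⇒All f [] [] = []
Pointwise-map⇒All f (x ∷ xs) (r ∷ rs) = r ∷ Pointwise-map⇒All f xs rs

¬¬-Pointwise : ∀ {a b r} {A : Set a} {B : Set b} {R : A → B → Set r} {n} (ys : Vec B n) →
               All (λ y → ¬ ¬ ∃ λ x → R x y) ys → ¬ ¬ ∃ λ (xs : Vec A n) → Pointwise R xs ys
¬¬-Pointwise [] [] ¬∃ = ¬∃ ([] , [])
¬¬-Pointwise (y ∷ ys) (¬¬∃x ∷ ¬¬∃xs) ¬∃ =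
  ¬¬∃x λ (x , Rxy) → ¬¬-Pointwise ys ¬¬∃xs λ (xs , Rxsys) → ¬∃ (x ∷ xs , Rxy ∷ Rxsys)

∃-Vec? : ∀ {q r} n {P : Vec (Fin q) n → Set r} → (∀ v → Dec (P v)) → Dec (∃ P)
∃-Vec? zero P? = Dec.map′ ([] ,_) (λ { ([] , P[]) → P[] }) (P? [])
∃-Vec? (suc n) P? = Dec.map′ (λ (b , v , Pbv) → b ∷ v , Pbv) (λ { (b ∷ v , Pbv) → b , v , Pbv })
                             (Fin.any? λ b → ∃-Vec? n (λ v → P? (b ∷ v)))

All-∷ʳ⁻ : ∀ {a r} {A : Set a} {P : A → Set r} {n} (xs : Vec A n) {x} → All P (xs ∷ʳ x) → P x
All-∷ʳ⁻ [] (Px ∷ []) = Px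
All-∷ʳ⁻ (_ ∷ xs) (_ ∷ Pxs) = All-∷ʳ⁻ xs Pxs

replicate⁺ : ∀ {a p} {A : Set a} {P : A → Set p} n {x} → P x → All P (Vec.replicate n x)
replicate⁺ zero px = []
replicate⁺ (suc n) px = px ∷ replicate⁺ n px

prime∤! : ∀ {p n} → Prime p → n < p → ¬ p ∣ n !
prime∤! {n = zero} pr _ p∣1 = ℕ.<⇒≢ (ℕ.nonTrivial⇒n>1 _ {{prime⇒nonTrivial pr}}) (≡.sym (∣1⇒≡1 p∣1))
prime∤! {n = suc n} pr n<p p∣n! with euclidsLemma (suc n) (n !) pr p∣n!
... | inj₁ p∣n = ℕ.<⇒≱ n<p (∣⇒≤ p∣n)
... | inj₂ p∣n! = prime∤! pr (ℕ.<-trans (ℕ.n<1+n n) n<p) p∣n!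

n∣n! : ∀ n → .{{NonZero n}} → n ∣ n !
n∣n! (suc n) = m∣m*n (n !)

p∣pCk : ∀ {p k} → Prime p → 0 < k → k < p → p ∣ p C k
p∣pCk {p} {k} pr 0<k k<p with euclidsLemma (p C k) (k ! ℕ.* (p ∸ k) !) pr p∣C*k!*[p-k]!
  where
  C*k!*[p-k]!≡p! : (p C k) ℕ.* (k ! ℕ.* (p ∸ k) !) ≡ p !
  C*k!*[p-k]!≡p! = ≡.trans (≡.cong (ℕ._* (k ! ℕ.* (p ∸ k) !)) (nCk≡n!/k![n-k]! (ℕ.<⇒≤ k<p)))
                           (m/n*n≡m {{k ℕ.!* (p ∸ k) !≢0}} (k![n∸k]!∣n! (ℕ.<⇒≤ k<p)))
  p∣C*k!*[p-k]! : p ∣ (p C k) ℕ.* (k ! ℕ.* (p ∸ k) !)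
  p∣C*k!*[p-k]! = ≡.subst (p ∣_) (≡.sym C*k!*[p-k]!≡p!) (n∣n! p {{prime⇒nonZero pr}})
... | inj₁ p∣C = p∣C
... | inj₂ p∣k!*[p-k]! with euclidsLemma (k !) ((p ∸ k) !) pr p∣k!*[p-k]!
...   | inj₁ p∣k! = contradiction p∣k! (prime∤! pr k<p)
...   | inj₂ p∣[p-k]! = contradiction p∣[p-k]! (prime∤! pr (ℕ.∸-monoʳ-< 0<k (ℕ.<⇒≤ k<p)))

prime∤⇒coprime : ∀ {p a} → Prime p → ¬ p ∣ a → Coprime p a
prime∤⇒coprime {a = a} pr p∤a (d∣p , d∣a) with prime⇒irreducible pr d∣p
... | inj₁ d≡1 = d≡1
... | inj₂ d≡p = contradiction (≡.subst (_∣ a) d≡p d∣a) p∤a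

Coprime-∣ʳ : ∀ {a b c} → Coprime a b → c ∣ b → Coprime a c
Coprime-∣ʳ a⊥b c∣b (d∣a , d∣c) = a⊥b (d∣a , ∣-trans d∣c c∣b)

IsLeastOrderIndex⇒coprime : ∀ {p m l} .{{_ : NonZero m}} → IsLeastOrderIndex p m l →
                            ∀ k → 0 < k → k < l → Coprime (p ℕ.^ k ∸ 1) m
IsLeastOrderIndex⇒coprime {p} {m} (_ , _ , least) k 0<k k<l =
  gcd≡1⇒coprime (ℕ.≤-antisym gcd≤1 (ℕ.n≢0⇒n>0 gcd≢0))
  where
  gcd≤1 : gcd (p ℕ.^ k ∸ 1) m ≤ 1
  gcd≤1 = ℕ.≮⇒≥ (λ 1<gcd → ℕ.<⇒≱ k<l (least k 0<k 1<gcd))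
  gcd≢0 : gcd (p ℕ.^ k ∸ 1) m ≢ 0
  gcd≢0 gcd≡0 = ℕ.≢-nonZero⁻¹ m (gcd[m,n]≡0⇒n≡0 (p ℕ.^ k ∸ 1) gcd≡0)

-- Polynomials over 𝔽ₚ as coefficient vectors in ℕ

shiftIn : ∀ {n} → ℕ → Vec ℕ n → Vec ℕ n × ℕ
shiftIn c [] = [] , c
shiftIn c (v ∷ vs) = Product.map₁ (c ∷_) (shiftIn v vs)

constOne : ∀ {n} → Vec ℕ n
constOne {zero} = []
constOne {suc n} = 1 ∷ Vec.replicate n 0

module _ (p : ℕ) .{{_ : NonZero p}} where

  -- ℕ has no negation: t · ((p ∸ 1) · b) stands for − t · b modulo p.
  subtractMultiple : ∀ {n} → ℕ → Vec ℕ n → Vec ℕ n → Vec ℕ n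
  subtractMultiple t = Vec.zipWith (λ w b → w ℕ.+ t ℕ.* ((p ∸ 1) ℕ.* b))

  xTimesMod : ∀ {n} → Vec ℕ n → Vec ℕ n → Vec ℕ n
  xTimesMod as v = subtractMultiple (proj₂ (shiftIn 0 v)) (proj₁ (shiftIn 0 v)) as

  xPowMod : ∀ {n} → Vec ℕ n → ℕ → Vec ℕ n
  xPowMod as zero = constOne
  xPowMod as (suc k) = xTimesMod as (xPowMod as k)

  -- xⁿ + Σᵢ asᵢ xⁱ divides xᵐ − 1 over 𝔽ₚ: reducing xᵐ modulo it leaves 1.
  Divides-xᵐ-1 : ∀ {n} → Vec ℕ n → ℕ → Set
  Divides-xᵐ-1 as m = Vec.map (_% p) (xPowMod as m) ≡ Vec.map (_% p) (xPowMod as 0)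

  -- f = xˡ + Σᵢ asᵢ xⁱ has f(1) ≢ 0 and divides xᵐ − 1 over 𝔽ₚ. Unlike membership of a field
  -- element in 𝔽ₚ, this is decidable.
  Certificate : ∀ {l} → ℕ → Vec ℕ l → Set
  Certificate m as = ¬ p ∣ Vec.sum (as ∷ʳ 1) × Divides-xᵐ-1 as m

  certificate? : ∀ {l} m (as : Vec ℕ l) → Dec (Certificate m as)
  certificate? m as = Dec.¬? (p ∣? Vec.sum (as ∷ʳ 1)) Dec.×-dec Vec.≡-dec ℕ._≟_ _ _

module _ {c ℓ : Level} (K : CommutativeRing c ℓ) where
  open CommutativeRing K hiding (zero)
  open import Relation.Binary.Reasoning.Setoid setoid
  open import Algebra.Properties.Semiring.Mult.TCOptimised semiring
    using (×-homo-+; ×1-homo-*; 1+×; ×ᵤ≈×) renaming (_×_ to _·_)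
  open import Algebra.Properties.Semiring.Mult semiring
    using () renaming (_×_ to _·ᵤ_; ×-congʳ to ×ᵤ-congʳ; ×-assoc-* to ×ᵤ-assoc-*)
  open import Algebra.Properties.Monoid.Sum +-monoid using (sum; sum-init-last; sum-cong-≋; sum-replicate-zero)
  import Algebra.Properties.CommutativeSemiring.Binomial commutativeSemiring as Binomial
  open import Algebra.Properties.CommutativeSemiring.Exp commutativeSemiring
    using (_^_; ^-assocʳ; ^-distrib-*; ^-congˡ)

  open import Algebra.Properties.Ring ring
    using (-0#≈0#; -‿involutive; -‿+-comm; -‿distribˡ-*; -‿distribʳ-*; x∙y⁻¹≈ε⇒x≈y; x≈y⇒x∙y⁻¹≈ε;
      +-inverseʳ-unique; +-inverseˡ-unique; x[y-z]≈xy-xz; +-cancelʳ)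

  ι : ℕ → Carrier
  ι n = n · 1#

  ι-+ : ∀ m n → ι (m ℕ.+ n) ≈ ι m + ι n
  ι-+ = ×-homo-+ 1#

  ι-* : ∀ m n → ι (m ℕ.* n) ≈ ι m * ι n
  ι-* = ×1-homo-*

  -- The ring solver needs a coefficient ring with decidable equality: ℤ, mapped into K.
  private
    ιℤ : ℤ → Carrier
    ιℤ (ℤ.+ n) = ι n
    ιℤ -[1+ n ] = - ι (suc n)

    ιℤ-⊖ : ∀ m n → ιℤ (m ⊖ n) ≈ ι m - ι n
    ιℤ-⊖ zero zero = sym (-‿inverseʳ 0#)
    ιℤ-⊖ zero (suc n) = sym (+-identityˡ _)
    ιℤ-⊖ (suc m) zero = sym (trans (+-congˡ -0#≈0#) (+-identityʳ _))
    ιℤ-⊖ (suc m) (suc n) = begin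
      ιℤ (suc m ⊖ suc n)            ≡⟨ ≡.cong ιℤ (ℤ.[1+m]⊖[1+n]≡m⊖n m n) ⟩
      ιℤ (m ⊖ n)                    ≈⟨ ιℤ-⊖ m n ⟩
      ι m - ι n                     ≈⟨ +-congʳ (sym (+-identityˡ _)) ⟩
      (0# + ι m) - ι n              ≈⟨ +-congʳ (+-congʳ (sym (-‿inverseʳ 1#))) ⟩
      ((1# - 1#) + ι m) - ι n
        ≈⟨ +-congʳ (trans (+-assoc _ _ _) (trans (+-congˡ (+-comm _ _)) (sym (+-assoc _ _ _)))) ⟩
      ((1# + ι m) - 1#) - ι n       ≈⟨ +-assoc _ _ _ ⟩
      (1# + ι m) + (- 1# - ι n)     ≈⟨ +-congˡ (-‿+-comm 1# (ι n)) ⟩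
      (1# + ι m) - (1# + ι n)       ≈⟨ +-cong (sym (1+× m 1#)) (-‿cong (sym (1+× n 1#))) ⟩
      ι (suc m) - ι (suc n)         ∎

    ιℤ-+ : ∀ i j → ιℤ (i ℤ.+ j) ≈ ιℤ i + ιℤ j
    ιℤ-+ (ℤ.+ m) (ℤ.+ n) = ι-+ m n
    ιℤ-+ (ℤ.+ m) -[1+ n ] = ιℤ-⊖ m (suc n)
    ιℤ-+ -[1+ m ] (ℤ.+ n) = trans (ιℤ-⊖ n (suc m)) (+-comm _ _)
    ιℤ-+ -[1+ m ] -[1+ n ] = begin
      - ι (suc (suc (m ℕ.+ n)))     ≡⟨ ≡.cong (λ k → - ι (suc k)) (≡.sym (ℕ.+-suc m n)) ⟩
      - ι (suc m ℕ.+ suc n)         ≈⟨ -‿cong (ι-+ (suc m) (suc n)) ⟩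
      - (ι (suc m) + ι (suc n))     ≈⟨ sym (-‿+-comm _ _) ⟩
      - ι (suc m) - ι (suc n)       ∎

    ιℤ-* : ∀ i j → ιℤ (i ℤ.* j) ≈ ιℤ i * ιℤ j
    ιℤ-* (ℤ.+ zero) j = sym (zeroˡ _)
    ιℤ-* i (ℤ.+ zero) = trans (reflexive (≡.cong ιℤ (ℤ.*-zeroʳ i))) (sym (zeroʳ _))
    ιℤ-* (ℤ.+ suc m) (ℤ.+ suc n) = ι-* (suc m) (suc n)
    ιℤ-* (ℤ.+ suc m) -[1+ n ] = trans (-‿cong (ι-* (suc m) (suc n))) (-‿distribʳ-* _ _)
    ιℤ-* -[1+ m ] (ℤ.+ suc n) = trans (-‿cong (ι-* (suc m) (suc n))) (-‿distribˡ-* _ _)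
    ιℤ-* -[1+ m ] -[1+ n ] = begin
      ι (suc m ℕ.* suc n)           ≈⟨ ι-* (suc m) (suc n) ⟩
      ι (suc m) * ι (suc n)         ≈⟨ sym (-‿involutive _) ⟩
      - - (ι (suc m) * ι (suc n))   ≈⟨ -‿cong (-‿distribˡ-* _ _) ⟩
      - (- ι (suc m) * ι (suc n))   ≈⟨ -‿distribʳ-* _ _ ⟩
      - ι (suc m) * - ι (suc n)     ∎

    ιℤ-neg : ∀ i → ιℤ (ℤ.- i) ≈ - ιℤ i
    ιℤ-neg (ℤ.+ zero) = sym -0#≈0#
    ιℤ-neg (ℤ.+ suc n) = refl
    ιℤ-neg -[1+ n ] = sym (-‿involutive _)

    ιℤ-homomorphism : ℤ.+-*-rawRing ACR.-Raw-AlmostCommutative⟶ ACR.fromCommutativeRing K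
    ιℤ-homomorphism = record
      { ⟦_⟧ = ιℤ ; +-homo = ιℤ-+ ; *-homo = ιℤ-* ; -‿homo = ιℤ-neg ; 0-homo = refl ; 1-homo = refl }

    ιℤ-≟ : ∀ i j → Maybe (ιℤ i ≈ ιℤ j)
    ιℤ-≟ i j = Maybe.map (λ i≡j → reflexive (≡.cong ιℤ i≡j)) (Dec.dec⇒maybe (i ℤ.≟ j))

  open import Algebra.Solver.Ring ℤ.+-*-rawRing (ACR.fromCommutativeRing K) ιℤ-homomorphism ιℤ-≟
    using (Polynomial; solve; _:=_; _:+_; _:*_; _:-_; :-_; con)

  private
    1#ₚ 0#ₚ : ∀ {n} → Polynomial n
    1#ₚ = con (ℤ.+ 1)
    0#ₚ = con (ℤ.+ 0)

  natCast≈ι : ∀ n → natCast K n ≈ ι n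
  natCast≈ι zero = refl
  natCast≈ι (suc n) = trans (+-congˡ (natCast≈ι n)) (sym (1+× n 1#))

  pow≡^ : ∀ x n → pow K x n ≡ x ^ n
  pow≡^ x zero = ≡.refl
  pow≡^ x (suc n) = ≡.cong (x *_) (pow≡^ x n)

  ι-∸ : ∀ {a b} → a ≤ b → ι (b ∸ a) ≈ ι b - ι a
  ι-∸ {a} {b} a≤b = begin
    ι (b ∸ a)                 ≈⟨ solve 2 (λ d a → d := (d :+ a) :- a) refl (ι (b ∸ a)) (ι a) ⟩
    (ι (b ∸ a) + ι a) - ι a   ≈⟨ +-congʳ (sym (ι-+ (b ∸ a) a)) ⟩
    ι (b ∸ a ℕ.+ a) - ι a     ≡⟨ ≡.cong (λ k → ι k - ι a) (ℕ.m∸n+n≡m a≤b) ⟩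
    ι b - ι a                 ∎

  1^n≈1 : ∀ n → 1# ^ n ≈ 1#
  1^n≈1 zero = refl
  1^n≈1 (suc n) = trans (*-identityˡ _) (1^n≈1 n)

  0^n≈0 : ∀ n .{{_ : NonZero n}} → 0# ^ n ≈ 0#
  0^n≈0 (suc n) = zeroˡ _

  ^-multiple≈1 : ∀ {x a} k → x ^ a ≈ 1# → x ^ (k ℕ.* a) ≈ 1#
  ^-multiple≈1 {x} {a} k xᵃ≈1 = begin
    x ^ (k ℕ.* a)   ≡⟨ ≡.cong (x ^_) (ℕ.*-comm k a) ⟩
    x ^ (a ℕ.* k)   ≈⟨ ^-assocʳ x a k ⟨
    (x ^ a) ^ k     ≈⟨ ^-congˡ k xᵃ≈1 ⟩
    1# ^ k          ≈⟨ 1^n≈1 k ⟩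
    1#              ∎

  root-^ : ∀ {y m} a → y ^ m ≈ 1# → (y ^ a) ^ m ≈ 1#
  root-^ {y} {m} a yᵐ≈1 = trans (^-assocʳ y a m) (^-multiple≈1 a yᵐ≈1)

  root-* : ∀ {x y m} → x ^ m ≈ 1# → y ^ m ≈ 1# → (x * y) ^ m ≈ 1#
  root-* {x} {y} {m} xᵐ≈1 yᵐ≈1 = trans (^-distrib-* x y m) (trans (*-cong xᵐ≈1 yᵐ≈1) (*-identityˡ 1#))

  private
    ^≈1-bézout : ∀ {x} a b s t → 1 ℕ.+ t ℕ.* b ≡ s ℕ.* a → x ^ a ≈ 1# → x ^ b ≈ 1# → x ≈ 1#
    ^≈1-bézout {x} a b s t eq xᵃ≈1 xᵇ≈1 = begin
      x                     ≈⟨ *-identityʳ x ⟨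
      x * 1#                ≈⟨ *-congˡ (^-multiple≈1 t xᵇ≈1) ⟨
      x ^ (1 ℕ.+ t ℕ.* b)   ≡⟨ ≡.cong (x ^_) eq ⟩
      x ^ (s ℕ.* a)         ≈⟨ ^-multiple≈1 s xᵃ≈1 ⟩
      1#                    ∎

  ^≈1-coprime⇒≈1 : ∀ {x a b} → Coprime a b → x ^ a ≈ 1# → x ^ b ≈ 1# → x ≈ 1#
  ^≈1-coprime⇒≈1 {a = a} {b} coprime xᵃ≈1 xᵇ≈1 with coprime-Bézout coprime
  ... | Bézout.+- s t eq = ^≈1-bézout a b s t eq xᵃ≈1 xᵇ≈1
  ... | Bézout.-+ s t eq = ^≈1-bézout b a t s eq xᵇ≈1 xᵃ≈1

  geometric-sum : ∀ k x → (x - 1#) * evalMonic K (List.replicate k 1#) x ≈ x ^ suc k - 1#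
  geometric-sum zero x = solve 1 (λ x → (x :- 1#ₚ) :* 1#ₚ := x :* 1#ₚ :- 1#ₚ) refl x
  geometric-sum (suc k) x = begin
    (x - 1#) * (1# + x * G)
      ≈⟨ solve 2 (λ x G → (x :- 1#ₚ) :* (1#ₚ :+ x :* G) := x :- 1#ₚ :+ x :* ((x :- 1#ₚ) :* G)) refl x G ⟩
    x - 1# + x * ((x - 1#) * G)   ≈⟨ +-congˡ (*-congˡ (geometric-sum k x)) ⟩
    x - 1# + x * (x ^ suc k - 1#)
      ≈⟨ solve 2 (λ x w → x :- 1#ₚ :+ x :* (w :- 1#ₚ) := x :* w :- 1#ₚ) refl x (x ^ suc k) ⟩
    x * x ^ suc k - 1#            ∎
    where
    G : Carrier
    G = evalMonic K (List.replicate k 1#) x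

  geometric-sum-at-1 : ∀ k → evalMonic K (List.replicate k 1#) 1# ≈ ι (suc k)
  geometric-sum-at-1 zero = refl
  geometric-sum-at-1 (suc k) = trans (+-congˡ (trans (*-identityˡ _) (geometric-sum-at-1 k))) (sym (1+× (suc k) 1#))

  evalMonic-congʳ : ∀ cs {x y} → x ≈ y → evalMonic K cs x ≈ evalMonic K cs y
  evalMonic-congʳ List.[] x≈y = refl
  evalMonic-congʳ (c List.∷ cs) x≈y = +-congˡ (*-cong x≈y (evalMonic-congʳ cs x≈y))

  eval : ∀ {n} → Vec Carrier n → Carrier → Carrier
  eval [] x = 0#
  eval (c ∷ cs) x = c + x * eval cs x

  monic : ∀ {n} → Vec Carrier n → Carrier → Carrier
  monic {n} cs x = eval cs x + x ^ n

  evalMonic≈monic : ∀ {n} (cs : Vec Carrier n) x → evalMonic K (Vec.toList cs) x ≈ monic cs x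
  evalMonic≈monic [] x = sym (+-identityˡ 1#)
  evalMonic≈monic {suc n} (c ∷ cs) x = begin
    c + x * evalMonic K (Vec.toList cs) x   ≈⟨ +-congˡ (*-congˡ (evalMonic≈monic cs x)) ⟩
    c + x * (eval cs x + x ^ n)
      ≈⟨ solve 4 (λ c x e w → c :+ x :* (e :+ w) := (c :+ x :* e) :+ x :* w) refl c x (eval cs x) (x ^ n) ⟩
    (c + x * eval cs x) + x * x ^ n         ∎

  eval-cong : ∀ {n} {us vs : Vec Carrier n} x → Pointwise _≈_ us vs → eval us x ≈ eval vs x
  eval-cong x [] = refl
  eval-cong x (u≈v ∷ us≈vs) = +-cong u≈v (*-congˡ (eval-cong x us≈vs))

  eval-congʳ : ∀ {n} (cs : Vec Carrier n) {x y} → x ≈ y → eval cs x ≈ eval cs y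
  eval-congʳ [] x≈y = refl
  eval-congʳ (c ∷ cs) x≈y = +-congˡ (*-cong x≈y (eval-congʳ cs x≈y))

  monic-congʳ : ∀ {n} (cs : Vec Carrier n) {x y} → x ≈ y → monic cs x ≈ monic cs y
  monic-congʳ {n} cs x≈y = +-cong (eval-congʳ cs x≈y) (^-congˡ n x≈y)

  eval-∷ʳ : ∀ {n} (cs : Vec Carrier n) c x → eval (cs ∷ʳ c) x ≈ eval cs x + x ^ n * c
  eval-∷ʳ [] c x = solve 2 (λ c x → c :+ x :* 0#ₚ := 0#ₚ :+ 1#ₚ :* c) refl c x
  eval-∷ʳ {suc n} (d ∷ cs) c x = begin
    d + x * eval (cs ∷ʳ c) x          ≈⟨ +-congˡ (*-congˡ (eval-∷ʳ cs c x)) ⟩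
    d + x * (eval cs x + x ^ n * c)
      ≈⟨ solve 5 (λ d x e w c → d :+ x :* (e :+ w :* c) := (d :+ x :* e) :+ (x :* w) :* c) refl d x (eval cs x) (x ^ n) c ⟩
    (d + x * eval cs x) + x ^ suc n * c ∎

  eval-∷ʳ1 : ∀ {n} (as : Vec ℕ n) x → eval (Vec.map ι (as ∷ʳ 1)) x ≈ monic (Vec.map ι as) x
  eval-∷ʳ1 {n} as x = begin
    eval (Vec.map ι (as ∷ʳ 1)) x       ≡⟨ ≡.cong (λ v → eval v x) (Vec.map-∷ʳ ι 1 as) ⟩
    eval (Vec.map ι as ∷ʳ 1#) x        ≈⟨ eval-∷ʳ (Vec.map ι as) 1# x ⟩
    eval (Vec.map ι as) x + x ^ n * 1# ≈⟨ +-congˡ (*-identityʳ _) ⟩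
    monic (Vec.map ι as) x             ∎

  eval-zeros : ∀ n x → eval (Vec.replicate n 0#) x ≈ 0#
  eval-zeros zero x = refl
  eval-zeros (suc n) x = trans (+-identityˡ _) (trans (*-congˡ (eval-zeros n x)) (zeroʳ x))

  eval-at-1 : ∀ {n} (as : Vec ℕ n) → eval (Vec.map ι as) 1# ≈ ι (Vec.sum as)
  eval-at-1 [] = refl
  eval-at-1 (a ∷ as) = trans (+-congˡ (trans (*-identityˡ _) (eval-at-1 as))) (sym (ι-+ a _))

  eval-difference : ∀ {n} (us vs : Vec Carrier n) x → eval (Vec.zipWith _-_ us vs) x ≈ eval us x - eval vs x
  eval-difference [] [] x = sym (-‿inverseʳ 0#)
  eval-difference (u ∷ us) (v ∷ vs) x = begin
    (u - v) + x * eval (Vec.zipWith _-_ us vs) x   ≈⟨ +-congˡ (*-congˡ (eval-difference us vs x)) ⟩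
    (u - v) + x * (eval us x - eval vs x)
      ≈⟨ solve 5 (λ u v x e f → (u :- v) :+ x :* (e :- f) := (u :+ x :* e) :- (v :+ x :* f))
                 refl u v x (eval us x) (eval vs x) ⟩
    (u + x * eval us x) - (v + x * eval vs x)      ∎

  eval-map-* : ∀ {n} k (vs : Vec Carrier n) x → eval (Vec.map (k *_) vs) x ≈ k * eval vs x
  eval-map-* k [] x = sym (zeroʳ k)
  eval-map-* k (v ∷ vs) x = begin
    k * v + x * eval (Vec.map (k *_) vs) x   ≈⟨ +-congˡ (*-congˡ (eval-map-* k vs x)) ⟩
    k * v + x * (k * eval vs x)
      ≈⟨ solve 4 (λ k v x e → k :* v :+ x :* (k :* e) := k :* (v :+ x :* e)) refl k v x (eval vs x) ⟩
    k * (v + x * eval vs x)                  ∎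

  eval-scaled : ∀ {n k} {cs bs : Vec ℕ n} x → Pointwise (λ c b → ι c ≈ k * ι b) cs bs →
                eval (Vec.map ι cs) x ≈ k * eval (Vec.map ι bs) x
  eval-scaled x [] = sym (zeroʳ _)
  eval-scaled {k = k} {c ∷ cs} {b ∷ bs} x (c≈kb ∷ cs≈kbs) = begin
    ι c + x * eval (Vec.map ι cs) x          ≈⟨ +-cong c≈kb (*-congˡ (eval-scaled x cs≈kbs)) ⟩
    k * ι b + x * (k * eval (Vec.map ι bs) x)
      ≈⟨ solve 4 (λ k b x e → k :* b :+ x :* (k :* e) := k :* (b :+ x :* e)) refl k (ι b) x _ ⟩
    k * (ι b + x * eval (Vec.map ι bs) x)    ∎

  sum-scaled : ∀ {n k} {cs bs : Vec ℕ n} → Pointwise (λ c b → ι c ≈ k * ι b) cs bs →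
               ι (Vec.sum cs) ≈ k * ι (Vec.sum bs)
  sum-scaled [] = sym (zeroʳ _)
  sum-scaled {k = k} {c ∷ cs} {b ∷ bs} (c≈kb ∷ cs≈kbs) = begin
    ι (c ℕ.+ Vec.sum cs)             ≈⟨ ι-+ c _ ⟩
    ι c + ι (Vec.sum cs)             ≈⟨ +-cong c≈kb (sum-scaled cs≈kbs) ⟩
    k * ι b + k * ι (Vec.sum bs)     ≈⟨ distribˡ k _ _ ⟨
    k * (ι b + ι (Vec.sum bs))       ≈⟨ *-congˡ (ι-+ b _) ⟨
    k * ι (b ℕ.+ Vec.sum bs)         ∎

  eval-shift : ∀ {n} c (vs : Vec ℕ n) x →
               eval (Vec.map ι (proj₁ (shiftIn c vs))) x + x ^ n * ι (proj₂ (shiftIn c vs)) ≈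
               ι c + x * eval (Vec.map ι vs) x
  eval-shift c [] x = solve 2 (λ c x → 0#ₚ :+ 1#ₚ :* c := c :+ x :* 0#ₚ) refl (ι c) x
  eval-shift {suc n} c (v ∷ vs) x = begin
    (ι c + x * E) + x * x ^ n * T
      ≈⟨ solve 5 (λ c x E w T → (c :+ x :* E) :+ x :* w :* T := c :+ x :* (E :+ w :* T)) refl (ι c) x E (x ^ n) T ⟩
    ι c + x * (E + x ^ n * T)            ≈⟨ +-congˡ (*-congˡ (eval-shift v vs x)) ⟩
    ι c + x * eval (Vec.map ι (v ∷ vs)) x ∎
    where
    E : Carrier
    E = eval (Vec.map ι (proj₁ (shiftIn v vs))) x
    T : Carrier
    T = ι (proj₂ (shiftIn v vs))

  linearProduct : ∀ {n} → (Fin n → Carrier) → Vec Carrier n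
  linearProduct {zero} ρ = []
  linearProduct {suc n} ρ = Vec.zipWith _-_ (0# ∷ cs) (Vec.map (ρ zero *_) (cs ∷ʳ 1#))
    where
    cs : Vec Carrier n
    cs = linearProduct (ρ ∘ Fin.suc)

  monic-linearProduct : ∀ {n} (ρ : Fin (suc n) → Carrier) x →
                        monic (linearProduct ρ) x ≈ (x - ρ zero) * monic (linearProduct (ρ ∘ Fin.suc)) x
  monic-linearProduct {n} ρ x = begin
    eval (Vec.zipWith _-_ (0# ∷ cs) (Vec.map (r *_) (cs ∷ʳ 1#))) x + x ^ suc n
      ≈⟨ +-congʳ (eval-difference (0# ∷ cs) (Vec.map (r *_) (cs ∷ʳ 1#)) x) ⟩
    ((0# + x * eval cs x) - eval (Vec.map (r *_) (cs ∷ʳ 1#)) x) + x * x ^ n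
      ≈⟨ +-congʳ (+-congˡ (-‿cong (trans (eval-map-* r (cs ∷ʳ 1#) x) (*-congˡ (eval-∷ʳ cs 1# x))))) ⟩
    ((0# + x * eval cs x) - r * (eval cs x + x ^ n * 1#)) + x * x ^ n
      ≈⟨ solve 4 (λ x r e w → ((0#ₚ :+ x :* e) :- r :* (e :+ w :* 1#ₚ)) :+ x :* w := (x :- r) :* (e :+ w))
                 refl x r (eval cs x) (x ^ n) ⟩
    (x - r) * (eval cs x + x ^ n) ∎
    where
    r : Carrier
    r = ρ zero
    cs : Vec Carrier n
    cs = linearProduct (ρ ∘ Fin.suc)

  linearProduct-root : ∀ {n} (ρ : Fin n → Carrier) i → monic (linearProduct ρ) (ρ i) ≈ 0#
  linearProduct-root ρ zero = trans (monic-linearProduct ρ (ρ zero)) (trans (*-congʳ (-‿inverseʳ _)) (zeroˡ _))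
  linearProduct-root ρ (suc i) =
    trans (monic-linearProduct ρ (ρ (suc i))) (trans (*-congˡ (linearProduct-root (ρ ∘ Fin.suc) i)) (zeroʳ _))

  ·ᵤ≈ι* : ∀ n z → n ·ᵤ z ≈ ι n * z
  ·ᵤ≈ι* n z = begin
    n ·ᵤ z          ≈⟨ ×ᵤ-congʳ n (*-identityˡ z) ⟨
    n ·ᵤ (1# * z)   ≈⟨ ×ᵤ-assoc-* n 1# z ⟨
    (n ·ᵤ 1#) * z   ≈⟨ *-congʳ (×ᵤ≈× n 1#) ⟩
    ι n * z         ∎

  binomials-vanish⇒^-homo-+ : ∀ n .{{_ : NonZero n}} → (∀ {k} → 0 < k → k < n → ι (n C k) ≈ 0#) →
                               ∀ x y → (x + y) ^ n ≈ x ^ n + y ^ n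
  binomials-vanish⇒^-homo-+ (suc q) middle≈0 x y = begin
    (x + y) ^ p                                       ≈⟨ Binomial.theorem p x y ⟩
    term zero + sum (tail term)                       ≈⟨ +-congˡ (sum-init-last (tail term)) ⟩
    term zero + (sum (init (tail term)) + term (suc (fromℕ q)))
      ≈⟨ +-cong first (+-cong (trans (sum-cong-≋ middle) (sum-replicate-zero q)) last) ⟩
    y ^ p + (0# + x ^ p)                              ≈⟨ trans (+-congˡ (+-identityˡ _)) (+-comm _ _) ⟩
    x ^ p + y ^ p                                     ∎
    where
    p : ℕ
    p = suc q
    τ : ℕ → Carrier
    τ k = (p C k) ·ᵤ (x ^ k * y ^ (p ∸ k))
    term : Fin (suc p) → Carrier
    term k = τ (toℕ k)
    first : τ 0 ≈ y ^ p
    first = trans (+-identityʳ _) (*-identityˡ _)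
    τ≈0 : ∀ {k} → 0 < k → k < p → τ k ≈ 0#
    τ≈0 {k} 0<k k<p = trans (·ᵤ≈ι* (p C k) _) (trans (*-congʳ (middle≈0 0<k k<p)) (zeroˡ _))
    middle : ∀ i → term (suc (Fin.inject₁ i)) ≈ 0#
    middle i = τ≈0 (s≤s z≤n) (s≤s k<q)
      where
      k<q : toℕ (Fin.inject₁ i) < q
      k<q = ≡.subst (_< q) (≡.sym (Fin.toℕ-inject₁ i)) (Fin.toℕ<n i)
    last : term (suc (fromℕ q)) ≈ x ^ p
    last = begin
      τ (suc (toℕ (fromℕ q)))   ≡⟨ ≡.cong (τ ∘ suc) (Fin.toℕ-fromℕ q) ⟩
      τ p                       ≡⟨ ≡.cong₂ (λ c e → c ·ᵤ (x ^ p * y ^ e)) (nCn≡1 p) (ℕ.n∸n≡0 p) ⟩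
      1 ·ᵤ (x ^ p * 1#)         ≈⟨ trans (+-identityʳ _) (*-identityʳ _) ⟩
      x ^ p                     ∎

  Σᵥ : ∀ {n} → Vec Carrier n → Carrier
  Σᵥ [] = 0#
  Σᵥ (x ∷ xs) = x + Σᵥ xs

  Σᵥ-++ : ∀ {m n} (xs : Vec Carrier m) (ys : Vec Carrier n) → Σᵥ (xs ++ ys) ≈ Σᵥ xs + Σᵥ ys
  Σᵥ-++ [] ys = sym (+-identityˡ _)
  Σᵥ-++ (x ∷ xs) ys = trans (+-congˡ (Σᵥ-++ xs ys)) (sym (+-assoc _ _ _))

  Σᵥ-replicate : ∀ k x → Σᵥ (Vec.replicate k x) ≈ ι k * x
  Σᵥ-replicate zero x = sym (zeroˡ x)
  Σᵥ-replicate (suc k) x = begin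
    x + Σᵥ (Vec.replicate k x)   ≈⟨ +-congˡ (Σᵥ-replicate k x) ⟩
    x + ι k * x                  ≈⟨ solve 2 (λ x i → x :+ i :* x := (1#ₚ :+ i) :* x) refl x (ι k) ⟩
    (1# + ι k) * x               ≈⟨ *-congʳ (1+× k 1#) ⟨
    ι (suc k) * x                ∎

  Σᵥ-map-* : ∀ {n} y (xs : Vec Carrier n) → Σᵥ (Vec.map (y *_) xs) ≈ y * Σᵥ xs
  Σᵥ-map-* y [] = sym (zeroʳ y)
  Σᵥ-map-* y (x ∷ xs) = trans (+-congˡ (Σᵥ-map-* y xs)) (sym (distribˡ y x (Σᵥ xs)))

  sumFin-lookup : ∀ {n} (xs : Vec Carrier n) → sumFin K (Vec.lookup xs) ≈ Σᵥ xs
  sumFin-lookup [] = refl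
  sumFin-lookup (x ∷ xs) = +-congˡ (sumFin-lookup xs)

  InW-fromVec : ∀ {m n} (αs : Vec Carrier n) → All (λ α → α ^ m ≈ 1#) αs → Σᵥ αs ≈ 0# → InW K m n
  InW-fromVec {m} αs αsᵐ≈1 Σαs≈0 =
    Vec.lookup αs , (λ i → trans (reflexive (pow≡^ _ m)) (All.lookup⁺ αsᵐ≈1 i)) , trans (sumFin-lookup αs) Σαs≈0

  powerCopies : ∀ {k} (cs : Vec ℕ k) → Carrier → Vec Carrier (Vec.sum cs)
  powerCopies [] x = []
  powerCopies (c ∷ cs) x = Vec.replicate c 1# ++ Vec.map (x *_) (powerCopies cs x)

  Σᵥ-powerCopies : ∀ {k} (cs : Vec ℕ k) x → Σᵥ (powerCopies cs x) ≈ eval (Vec.map ι cs) x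
  Σᵥ-powerCopies [] x = refl
  Σᵥ-powerCopies (c ∷ cs) x = begin
    Σᵥ (Vec.replicate c 1# ++ Vec.map (x *_) (powerCopies cs x))
      ≈⟨ Σᵥ-++ (Vec.replicate c 1#) _ ⟩
    Σᵥ (Vec.replicate c 1#) + Σᵥ (Vec.map (x *_) (powerCopies cs x))
      ≈⟨ +-cong (trans (Σᵥ-replicate c 1#) (*-identityʳ (ι c)))
                (trans (Σᵥ-map-* x (powerCopies cs x)) (*-congˡ (Σᵥ-powerCopies cs x))) ⟩
    ι c + x * eval (Vec.map ι cs) x   ∎

  powerCopies-roots : ∀ {k m x} (cs : Vec ℕ k) → x ^ m ≈ 1# → All (λ α → α ^ m ≈ 1#) (powerCopies cs x)
  powerCopies-roots {m = m} {x} [] xᵐ≈1 = []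
  powerCopies-roots {m = m} {x} (c ∷ cs) xᵐ≈1 =
    All.++⁺ (replicate⁺ c (1^n≈1 m))
            (All.map⁺ (All.map (root-* {m = m} xᵐ≈1) (powerCopies-roots {m = m} cs xᵐ≈1)))

  relation⇒InW : ∀ {k m x} (cs : Vec ℕ k) → x ^ m ≈ 1# → eval (Vec.map ι cs) x ≈ 0# → InW K m (Vec.sum cs)
  relation⇒InW {m = m} {x} cs xᵐ≈1 cs[x]≈0 =
    InW-fromVec {m} (powerCopies cs x) (powerCopies-roots {m = m} cs xᵐ≈1) (trans (Σᵥ-powerCopies cs x) cs[x]≈0)

  InW-∣ : ∀ {d m n} → d ∣ m → InW K d n → InW K m n
  InW-∣ {d} {m} (divides q ≡.refl) (α , αᵈ≈1 , Σα≈0) = α , αᵐ≈1 , Σα≈0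
    where
    αᵐ≈1 : ∀ i → pow K (α i) (q ℕ.* d) ≈ 1#
    αᵐ≈1 i =
      trans (reflexive (pow≡^ (α i) (q ℕ.* d))) (^-multiple≈1 q (trans (reflexive (≡.sym (pow≡^ (α i) d))) (αᵈ≈1 i)))

  module _ (isField : IsField K) where

    1≉0 : ¬ 1# ≈ 0#
    1≉0 = proj₁ isField

    *-cancelˡ-≈0 : ∀ {x y} → ¬ x ≈ 0# → x * y ≈ 0# → y ≈ 0#
    *-cancelˡ-≈0 {x} {y} x≉0 xy≈0 with proj₂ isField x x≉0
    ... | x⁻¹ , xx⁻¹≈1 = begin
      y                ≈⟨ *-identityˡ y ⟨
      1# * y           ≈⟨ *-congʳ xx⁻¹≈1 ⟨
      (x * x⁻¹) * y    ≈⟨ solve 3 (λ x x⁻¹ y → (x :* x⁻¹) :* y := x⁻¹ :* (x :* y)) refl x x⁻¹ y ⟩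
      x⁻¹ * (x * y)    ≈⟨ *-congˡ xy≈0 ⟩
      x⁻¹ * 0#         ≈⟨ zeroʳ x⁻¹ ⟩
      0#               ∎

    *-≉0 : ∀ {x y} → ¬ x ≈ 0# → ¬ y ≈ 0# → ¬ x * y ≈ 0#
    *-≉0 x≉0 y≉0 xy≈0 = y≉0 (*-cancelˡ-≈0 x≉0 xy≈0)

    *-cancelˡ : ∀ {x y z} → ¬ x ≈ 0# → x * y ≈ x * z → y ≈ z
    *-cancelˡ {x} {y} {z} x≉0 xy≈xz =
      x∙y⁻¹≈ε⇒x≈y y z (*-cancelˡ-≈0 x≉0 (trans (x[y-z]≈xy-xz x y z) (x≈y⇒x∙y⁻¹≈ε xy≈xz)))

    x≉y⇒x-y≉0 : ∀ {x y} → ¬ x ≈ y → ¬ x - y ≈ 0#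
    x≉y⇒x-y≉0 x≉y x-y≈0 = x≉y (x∙y⁻¹≈ε⇒x≈y _ _ x-y≈0)

    ^≈1⇒≉0 : ∀ {x} n .{{_ : NonZero n}} → x ^ n ≈ 1# → ¬ x ≈ 0#
    ^≈1⇒≉0 {x} (suc n) xⁿ⁺¹≈1 x≈0 = 1≉0 (begin
      1#           ≈⟨ xⁿ⁺¹≈1 ⟨
      x * x ^ n    ≈⟨ *-congʳ x≈0 ⟩
      0# * x ^ n   ≈⟨ zeroˡ _ ⟩
      0#           ∎)

    linearProduct-≉0 : ∀ {n} (ρ : Fin n → Carrier) {x} → (∀ i → ¬ x ≈ ρ i) →
                       ¬ monic (linearProduct ρ) x ≈ 0#
    linearProduct-≉0 {zero} ρ _ e = 1≉0 (trans (sym (+-identityˡ 1#)) e)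
    linearProduct-≉0 {suc n} ρ {x} x≉ρ e =
      *-≉0 (x≉y⇒x-y≉0 (x≉ρ zero)) (linearProduct-≉0 (ρ ∘ Fin.suc) (x≉ρ ∘ Fin.suc))
        (trans (sym (monic-linearProduct ρ x)) e)

    quotient : ∀ {n} → Carrier → Vec Carrier (suc n) → Vec Carrier n
    quotient r (c ∷ []) = []
    quotient r (c ∷ d ∷ cs) = eval (d ∷ cs) r ∷ quotient r (d ∷ cs)

    factor-theorem : ∀ {n} r (cs : Vec Carrier (suc n)) x →
                     eval cs x ≈ eval cs r + (x - r) * eval (quotient r cs) x
    factor-theorem r (c ∷ []) x = solve 3 (λ c x r → c :+ x :* 0#ₚ := (c :+ r :* 0#ₚ) :+ (x :- r) :* 0#ₚ) refl c x r
    factor-theorem r (c ∷ d ∷ cs) x = begin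
      c + x * eval (d ∷ cs) x               ≈⟨ +-congˡ (*-congˡ (factor-theorem r (d ∷ cs) x)) ⟩
      c + x * (e + (x - r) * q)
        ≈⟨ solve 5 (λ c x r e q → c :+ x :* (e :+ (x :- r) :* q) := (c :+ r :* e) :+ (x :- r) :* (e :+ x :* q))
                   refl c x r e q ⟩
      (c + r * e) + (x - r) * (e + x * q)   ∎
      where
      e : Carrier
      e = eval (d ∷ cs) r
      q : Carrier
      q = eval (quotient r (d ∷ cs)) x

    quotient-≈0⇒≈0 : ∀ {n} r (cs : Vec Carrier (suc n)) → eval cs r ≈ 0# →
                     All (_≈ 0#) (quotient r cs) → All (_≈ 0#) cs
    quotient-≈0⇒≈0 r (c ∷ []) c+r0≈0 [] = trans (sym (trans (+-congˡ (zeroʳ r)) (+-identityʳ c))) c+r0≈0 ∷ []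
    quotient-≈0⇒≈0 r (c ∷ d ∷ cs) cs[r]≈0 (e≈0 ∷ q≈0) = c≈0 ∷ quotient-≈0⇒≈0 r (d ∷ cs) e≈0 q≈0
      where
      c≈0 : c ≈ 0#
      c≈0 = begin
        c                        ≈⟨ +-identityʳ c ⟨
        c + 0#                   ≈⟨ +-congˡ (trans (*-congˡ e≈0) (zeroʳ r)) ⟨
        c + r * eval (d ∷ cs) r  ≈⟨ cs[r]≈0 ⟩
        0#                       ∎

    vanishing⇒zero : ∀ {n} (cs : Vec Carrier n) (ρ : Fin n → Carrier) → Injective _≡_ _≈_ ρ →
                     (∀ i → eval cs (ρ i) ≈ 0#) → All (_≈ 0#) cs
    vanishing⇒zero [] ρ _ _ = []
    vanishing⇒zero {suc n} (c ∷ cs) ρ ρ-inj cs[ρ]≈0 =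
      quotient-≈0⇒≈0 r (c ∷ cs) (cs[ρ]≈0 zero)
        (vanishing⇒zero q (ρ ∘ Fin.suc) (λ e → Fin.suc-injective (ρ-inj e)) q[ρ]≈0)
      where
      r : Carrier
      r = ρ zero
      q : Vec Carrier n
      q = quotient r (c ∷ cs)
      q[ρ]≈0 : ∀ i → eval q (ρ (suc i)) ≈ 0#
      q[ρ]≈0 i = *-cancelˡ-≈0 (x≉y⇒x-y≉0 (λ e → Fin.0≢1+n (≡.sym (ρ-inj e)))) (begin
        (x - r) * eval q x                    ≈⟨ +-identityˡ _ ⟨
        0# + (x - r) * eval q x               ≈⟨ +-congʳ (cs[ρ]≈0 zero) ⟨
        eval (c ∷ cs) r + (x - r) * eval q x  ≈⟨ factor-theorem r (c ∷ cs) x ⟨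
        eval (c ∷ cs) x                       ≈⟨ cs[ρ]≈0 (suc i) ⟩
        0#                                    ∎)
        where
        x : Carrier
        x = ρ (suc i)

    agree⇒≈ : ∀ {n} (us vs : Vec Carrier n) (ρ : Fin n → Carrier) → Injective _≡_ _≈_ ρ →
              (∀ i → eval us (ρ i) ≈ eval vs (ρ i)) → Pointwise _≈_ us vs
    agree⇒≈ us vs ρ ρ-inj us≈vs = differences us vs (vanishing⇒zero (Vec.zipWith _-_ us vs) ρ ρ-inj
      (λ i → trans (eval-difference us vs (ρ i)) (x≈y⇒x∙y⁻¹≈ε (us≈vs i))))
      where
      differences : ∀ {n} (us vs : Vec Carrier n) → All (_≈ 0#) (Vec.zipWith _-_ us vs) → Pointwise _≈_ us vs
      differences [] [] [] = []
      differences (u ∷ us) (v ∷ vs) (u-v≈0 ∷ rest) = x∙y⁻¹≈ε⇒x≈y u v u-v≈0 ∷ differences us vs rest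

    ^-fixed-points-bound : ∀ n → 1 < n → (ρ : Fin (suc n) → Carrier) → Injective _≡_ _≈_ ρ →
                           ¬ (∀ i → ρ i ^ n ≈ ρ i)
    ^-fixed-points-bound (suc zero) (s≤s ())
    ^-fixed-points-bound (suc (suc q)) _ ρ ρ-injective fixed =
      1≉0 (All-∷ʳ⁻ (Vec.replicate q 0#) (All.tail (All.tail (vanishing⇒zero xⁿ-x ρ ρ-injective roots))))
      where
      xⁿ-x : Vec Carrier (suc (suc (suc q)))
      xⁿ-x = 0# ∷ - 1# ∷ (Vec.replicate q 0# ∷ʳ 1#)
      eval-xⁿ-x : ∀ x → eval xⁿ-x x ≈ x ^ suc (suc q) - x
      eval-xⁿ-x x = begin
        0# + x * (- 1# + x * eval (Vec.replicate q 0# ∷ʳ 1#) x)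
          ≈⟨ +-congˡ (*-congˡ (+-congˡ (*-congˡ (eval-∷ʳ (Vec.replicate q 0#) 1# x)))) ⟩
        0# + x * (- 1# + x * (eval (Vec.replicate q 0#) x + x ^ q * 1#))
          ≈⟨ +-congˡ (*-congˡ (+-congˡ (*-congˡ (+-congʳ (eval-zeros q x))))) ⟩
        0# + x * (- 1# + x * (0# + x ^ q * 1#))
          ≈⟨ solve 2 (λ x w → 0#ₚ :+ x :* (:- 1#ₚ :+ x :* (0#ₚ :+ w :* 1#ₚ)) := x :* (x :* w) :- x) refl x (x ^ q) ⟩
        x * (x * x ^ q) - x                                       ∎
      roots : ∀ i → eval xⁿ-x (ρ i) ≈ 0#
      roots i = trans (eval-xⁿ-x (ρ i)) (x≈y⇒x∙y⁻¹≈ε (fixed i))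

  module _ {p} (isPrime : Prime p) (char : HasChar K p) where

    private instance
      p≢0 : NonZero p
      p≢0 = prime⇒nonZero isPrime

    ιp≈0 : ι p ≈ 0#
    ιp≈0 = trans (sym (natCast≈ι p)) char

    ι-∣⇒≈0 : ∀ {a} → p ∣ a → ι a ≈ 0#
    ι-∣⇒≈0 (divides q ≡.refl) = trans (ι-* q p) (trans (*-congˡ ιp≈0) (zeroʳ _))

    ι-mod : ∀ a → ι (a % p) ≈ ι a
    ι-mod a = sym (begin
      ι a                               ≡⟨ ≡.cong ι (m≡m%n+[m/n]*n a p) ⟩
      ι (a % p ℕ.+ a / p ℕ.* p)         ≈⟨ ι-+ (a % p) _ ⟩
      ι (a % p) + ι (a / p ℕ.* p)       ≈⟨ +-congˡ (ι-∣⇒≈0 (n∣m*n (a / p))) ⟩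
      ι (a % p) + 0#                    ≈⟨ +-identityʳ _ ⟩
      ι (a % p)                         ∎)

    ι[p-1]≈-1 : ι (p ∸ 1) ≈ - 1#
    ι[p-1]≈-1 = trans (ι-∸ (ℕ.>-nonZero⁻¹ p)) (trans (+-congʳ ιp≈0) (+-identityˡ _))

    ι-invertible : ∀ {a} → ¬ p ∣ a → ∃ λ w → ι w * ι a ≈ 1#
    ι-invertible {a} p∤a with coprime-Bézout (prime∤⇒coprime isPrime p∤a)
    ... | Bézout.+- s t 1+ta≡sp = (p ∸ 1) ℕ.* t , (begin
      ι ((p ∸ 1) ℕ.* t) * ι a   ≈⟨ *-congʳ (ι-* (p ∸ 1) t) ⟩
      ι (p ∸ 1) * ι t * ι a     ≈⟨ trans (*-assoc _ _ _) (*-cong ι[p-1]≈-1 (trans (sym (ι-* t a)) ιta≈-1)) ⟩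
      - 1# * - 1#               ≈⟨ solve 0 (:- 1#ₚ :* :- 1#ₚ := 1#ₚ) refl ⟩
      1#                        ∎)
      where
      ιta≈-1 : ι (t ℕ.* a) ≈ - 1#
      ιta≈-1 = +-inverseʳ-unique 1# _ (begin
        1# + ι (t ℕ.* a)      ≈⟨ ι-+ 1 (t ℕ.* a) ⟨
        ι (1 ℕ.+ t ℕ.* a)     ≡⟨ ≡.cong ι 1+ta≡sp ⟩
        ι (s ℕ.* p)           ≈⟨ ι-∣⇒≈0 (n∣m*n s) ⟩
        0#                    ∎)
    ... | Bézout.-+ s t 1+sp≡ta = t , (begin
      ι t * ι a             ≈⟨ ι-* t a ⟨
      ι (t ℕ.* a)           ≡⟨ ≡.cong ι 1+sp≡ta ⟨
      ι (1 ℕ.+ s ℕ.* p)     ≈⟨ ι-+ 1 (s ℕ.* p) ⟩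
      1# + ι (s ℕ.* p)      ≈⟨ +-congˡ (ι-∣⇒≈0 (n∣m*n s)) ⟩
      1# + 0#               ≈⟨ +-identityʳ 1# ⟩
      1#                    ∎)

    ^p-homo-+ : ∀ x y → (x + y) ^ p ≈ x ^ p + y ^ p
    ^p-homo-+ = binomials-vanish⇒^-homo-+ p (λ 0<k k<p → ι-∣⇒≈0 (p∣pCk isPrime 0<k k<p))

    ι^p≈ι : ∀ a → ι a ^ p ≈ ι a
    ι^p≈ι zero = 0^n≈0 p
    ι^p≈ι (suc a) = begin
      ι (suc a) ^ p         ≈⟨ ^-congˡ p (1+× a 1#) ⟩
      (1# + ι a) ^ p        ≈⟨ ^p-homo-+ 1# (ι a) ⟩
      1# ^ p + ι a ^ p      ≈⟨ +-cong (1^n≈1 p) (ι^p≈ι a) ⟩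
      1# + ι a              ≈⟨ 1+× a 1# ⟨
      ι (suc a)             ∎

    eval-^p : ∀ {n} (cs : Vec Carrier n) x → eval (Vec.map (_^ p) cs) (x ^ p) ≈ eval cs x ^ p
    eval-^p [] x = sym (0^n≈0 p)
    eval-^p (c ∷ cs) x = begin
      c ^ p + x ^ p * eval (Vec.map (_^ p) cs) (x ^ p)  ≈⟨ +-congˡ (*-congˡ (eval-^p cs x)) ⟩
      c ^ p + x ^ p * eval cs x ^ p                     ≈⟨ +-congˡ (^-distrib-* x _ p) ⟨
      c ^ p + (x * eval cs x) ^ p                       ≈⟨ ^p-homo-+ c _ ⟨
      (c + x * eval cs x) ^ p                           ∎

    monic-^p : ∀ {n} (cs : Vec Carrier n) x → monic (Vec.map (_^ p) cs) (x ^ p) ≈ monic cs x ^ p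
    monic-^p {n} cs x = begin
      eval (Vec.map (_^ p) cs) (x ^ p) + (x ^ p) ^ n   ≈⟨ +-cong (eval-^p cs x) (^-assocʳ x p n) ⟩
      eval cs x ^ p + x ^ (p ℕ.* n)
        ≡⟨ ≡.cong (λ e → eval cs x ^ p + x ^ e) (ℕ.*-comm p n) ⟩
      eval cs x ^ p + x ^ (n ℕ.* p)                    ≈⟨ +-congˡ (^-assocʳ x n p) ⟨
      eval cs x ^ p + (x ^ n) ^ p                      ≈⟨ ^p-homo-+ _ _ ⟨
      (eval cs x + x ^ n) ^ p                          ∎

    -- Scale the relation by u with u · f(1) ≡ n (mod p) and reduce the coefficients of x, …, xˡ
    -- mod p; the constant coefficient n ∸ C then makes the total count n.
    relation⇒InW-beyond : ∀ {l m x} (f : Vec ℕ (suc l)) → x ^ m ≈ 1# → eval (Vec.map ι f) x ≈ 0# →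
                          ¬ p ∣ Vec.sum f → ∀ n → l ℕ.* (p ∸ 1) ≤ n → InW K m n
    relation⇒InW-beyond {l} {m} {x} (f₀ ∷ f) xᵐ≈1 f[x]≈0 p∤Σf n l[p-1]≤n with ι-invertible p∤Σf
    ... | w , ιw*ιΣf≈1 = ≡.subst (InW K m) (ℕ.m∸n+n≡m C≤n) (relation⇒InW {m = m} {x} cs xᵐ≈1 (begin
      eval (Vec.map ι cs) x            ≈⟨ eval-scaled {cs = cs} {f₀ ∷ f} x (ι[n∸C]≈ιu*ιf₀ ∷ g≈uf) ⟩
      ι u * eval (Vec.map ι (f₀ ∷ f)) x ≈⟨ *-congˡ f[x]≈0 ⟩
      ι u * 0#                          ≈⟨ zeroʳ _ ⟩
      0#                                ∎))
      where
      u : ℕ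
      u = w ℕ.* n
      g : Vec ℕ l
      g = Vec.map (λ b → (u ℕ.* b) % p) f
      C : ℕ
      C = Vec.sum g
      cs : Vec ℕ (suc l)
      cs = (n ∸ C) ∷ g
      C≤n : C ≤ n
      C≤n = ℕ.≤-trans (sum-map-≤ _ (λ b → ℕ.suc[m]≤n⇒m≤pred[n] (m%n<n (u ℕ.* b) p)) f) l[p-1]≤n
      g≈uf : Pointwise (λ c b → ι c ≈ ι u * ι b) g f
      g≈uf = Pointwise-mapˡ (λ b → (u ℕ.* b) % p) (Pointwise.refl (λ {b} → trans (ι-mod (u ℕ.* b)) (ι-* u b)))
      ιn≈ιu*ιΣf : ι n ≈ ι u * ι (f₀ ℕ.+ Vec.sum f)
      ιn≈ιu*ιΣf = begin
        ι n                                  ≈⟨ *-identityʳ _ ⟨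
        ι n * 1#                             ≈⟨ *-congˡ ιw*ιΣf≈1 ⟨
        ι n * (ι w * ι (f₀ ℕ.+ Vec.sum f))
          ≈⟨ solve 3 (λ n w s → n :* (w :* s) := (w :* n) :* s) refl (ι n) (ι w) _ ⟩
        ι w * ι n * ι (f₀ ℕ.+ Vec.sum f)      ≈⟨ *-congʳ (ι-* w n) ⟨
        ι u * ι (f₀ ℕ.+ Vec.sum f)            ∎
      ι[n∸C]≈ιu*ιf₀ : ι (n ∸ C) ≈ ι u * ι f₀
      ι[n∸C]≈ιu*ιf₀ = begin
        ι (n ∸ C)                                          ≈⟨ ι-∸ C≤n ⟩
        ι n - ι C                                          ≈⟨ +-cong ιn≈ιu*ιΣf (-‿cong (sum-scaled g≈uf)) ⟩
        ι u * ι (f₀ ℕ.+ Vec.sum f) - ι u * ι (Vec.sum f)    ≈⟨ +-congʳ (*-congˡ (ι-+ f₀ _)) ⟩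
        ι u * (ι f₀ + ι (Vec.sum f)) - ι u * ι (Vec.sum f)
          ≈⟨ solve 3 (λ u a b → u :* (a :+ b) :- u :* b := u :* a) refl (ι u) (ι f₀) _ ⟩
        ι u * ι f₀                                         ∎

    eval-subtractMultiple : ∀ {n} t (ws as : Vec ℕ n) x →
      eval (Vec.map ι (subtractMultiple p t ws as)) x ≈ eval (Vec.map ι ws) x - ι t * eval (Vec.map ι as) x
    eval-subtractMultiple t [] [] x = solve 1 (λ t → 0#ₚ := 0#ₚ :- t :* 0#ₚ) refl (ι t)
    eval-subtractMultiple t (w ∷ ws) (b ∷ as) x = begin
      ι (w ℕ.+ t ℕ.* ((p ∸ 1) ℕ.* b)) + x * eval (Vec.map ι (subtractMultiple p t ws as)) x
        ≈⟨ +-cong ι[w-tb] (*-congˡ (eval-subtractMultiple t ws as x)) ⟩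
      (ι w + ι t * (- 1# * ι b)) + x * (E - ι t * F)
        ≈⟨ solve 6 (λ w t b x E F → (w :+ t :* (:- 1#ₚ :* b)) :+ x :* (E :- t :* F)
                                   := (w :+ x :* E) :- t :* (b :+ x :* F)) refl (ι w) (ι t) (ι b) x E F ⟩
      (ι w + x * E) - ι t * (ι b + x * F) ∎
      where
      E : Carrier
      E = eval (Vec.map ι ws) x
      F : Carrier
      F = eval (Vec.map ι as) x
      ι[w-tb] : ι (w ℕ.+ t ℕ.* ((p ∸ 1) ℕ.* b)) ≈ ι w + ι t * (- 1# * ι b)
      ι[w-tb] = trans (ι-+ w _) (+-congˡ (trans (ι-* t _) (*-congˡ (trans (ι-* (p ∸ 1) b) (*-congʳ ι[p-1]≈-1)))))

    eval-xTimesMod : ∀ {n} (as v : Vec ℕ n) {x} → monic (Vec.map ι as) x ≈ 0# →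
                     eval (Vec.map ι (xTimesMod p as v)) x ≈ x * eval (Vec.map ι v) x
    eval-xTimesMod {n} as v {x} as[x]≈0 = begin
      eval (Vec.map ι (xTimesMod p as v)) x       ≈⟨ eval-subtractMultiple t ws as x ⟩
      eval (Vec.map ι ws) x - ι t * F
        ≈⟨ +-congˡ (-‿cong (*-congˡ (+-inverseˡ-unique F (x ^ n) as[x]≈0))) ⟩
      eval (Vec.map ι ws) x - ι t * - x ^ n
        ≈⟨ solve 3 (λ E t w → E :- t :* (:- w) := E :+ w :* t) refl _ (ι t) (x ^ n) ⟩
      eval (Vec.map ι ws) x + x ^ n * ι t      ≈⟨ eval-shift 0 v x ⟩
      0# + x * eval (Vec.map ι v) x            ≈⟨ +-identityˡ _ ⟩
      x * eval (Vec.map ι v) x                 ∎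
      where
      ws : Vec ℕ n
      ws = proj₁ (shiftIn 0 v)
      t : ℕ
      t = proj₂ (shiftIn 0 v)
      F : Carrier
      F = eval (Vec.map ι as) x

    eval-xPowMod : ∀ {n} (as : Vec ℕ n) {x} → monic (Vec.map ι as) x ≈ 0# → ∀ k →
                   eval (Vec.map ι (xPowMod p as k)) x ≈ x ^ k
    eval-xPowMod [] as[x]≈0 zero = sym (trans (sym (+-identityˡ 1#)) as[x]≈0)
    eval-xPowMod {suc n} as {x} as[x]≈0 zero = begin
      1# + x * eval (Vec.map ι (Vec.replicate n 0)) x
        ≡⟨ ≡.cong (λ v → 1# + x * eval v x) (Vec.map-replicate ι 0 n) ⟩
      1# + x * eval (Vec.replicate n 0#) x
        ≈⟨ +-congˡ (trans (*-congˡ (eval-zeros n x)) (zeroʳ x)) ⟩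
      1# + 0#                                           ≈⟨ +-identityʳ 1# ⟩
      1#                                                ∎
    eval-xPowMod as as[x]≈0 (suc k) =
      trans (eval-xTimesMod as (xPowMod p as k) as[x]≈0) (*-congˡ (eval-xPowMod as as[x]≈0 k))

    eval-mod : ∀ {n} (v : Vec ℕ n) x → eval (Vec.map ι (Vec.map (_% p) v)) x ≈ eval (Vec.map ι v) x
    eval-mod [] x = refl
    eval-mod (c ∷ v) x = +-cong (ι-mod c) (*-congˡ (eval-mod v x))

    Divides-xᵐ-1⇒^≈1 : ∀ {n m x} (as : Vec ℕ n) → monic (Vec.map ι as) x ≈ 0# →
                       Divides-xᵐ-1 p as m → x ^ m ≈ 1#
    Divides-xᵐ-1⇒^≈1 {m = m} {x} as as[x]≈0 reduces-to-1 = begin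
      x ^ m                                                   ≈⟨ eval-xPowMod as as[x]≈0 m ⟨
      eval (Vec.map ι (xPowMod p as m)) x                        ≈⟨ eval-mod (xPowMod p as m) x ⟨
      eval (Vec.map ι (Vec.map (_% p) (xPowMod p as m))) x
        ≡⟨ ≡.cong (λ v → eval (Vec.map ι v) x) reduces-to-1 ⟩
      eval (Vec.map ι (Vec.map (_% p) (xPowMod p as 0))) x       ≈⟨ eval-mod (xPowMod p as 0) x ⟩
      eval (Vec.map ι (xPowMod p as 0)) x                        ≈⟨ eval-xPowMod as as[x]≈0 0 ⟩
      1#                                                      ∎

  module _ (isField : IsField K) {p} (isPrime : Prime p) (char : HasChar K p) where

    private instance
      p≢0 : NonZero p
      p≢0 = prime⇒nonZero isPrime

    ι≉0 : ∀ {a} → ¬ p ∣ a → ¬ ι a ≈ 0#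
    ι≉0 p∤a ιa≈0 with ι-invertible isPrime char p∤a
    ... | w , ιw*ιa≈1 = 1≉0 isField (trans (sym ιw*ιa≈1) (trans (*-congˡ ιa≈0) (zeroʳ _)))

    ι-distinct : ∀ {a b} → a < b → b < p → ¬ ι a ≈ ι b
    ι-distinct {a} {b} a<b b<p ιa≈ιb = ι≉0 p∤b-a (trans (ι-∸ (ℕ.<⇒≤ a<b)) (x≈y⇒x∙y⁻¹≈ε (sym ιa≈ιb)))
      where
      p∤b-a : ¬ p ∣ b ∸ a
      p∤b-a p∣b-a =
        ℕ.<⇒≱ (ℕ.≤-<-trans (ℕ.m∸n≤m b a) b<p) (∣⇒≤ {{ℕ.>-nonZero (ℕ.m<n⇒0<n∸m a<b)}} p∣b-a)

    ι-injective-< : ∀ {a b} → a < p → b < p → ι a ≈ ι b → a ≡ b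
    ι-injective-< {a} {b} a<p b<p ιa≈ιb with ℕ.<-cmp a b
    ... | tri< a<b _ _ = contradiction ιa≈ιb (ι-distinct a<b b<p)
    ... | tri≈ _ a≡b _ = a≡b
    ... | tri> _ _ b<a = contradiction (sym ιa≈ιb) (ι-distinct b<a a<p)

    ι-injective-mod : ∀ a b → ι a ≈ ι b → a % p ≡ b % p
    ι-injective-mod a b ιa≈ιb =
      ι-injective-< (m%n<n a p) (m%n<n b p) (trans (ι-mod isPrime char a) (trans ιa≈ιb (sym (ι-mod isPrime char b))))

    ι-Pointwise⇒mod≡ : ∀ {n} (us vs : Vec ℕ n) → Pointwise _≈_ (Vec.map ι us) (Vec.map ι vs) →
                       Vec.map (_% p) us ≡ Vec.map (_% p) vs
    ι-Pointwise⇒mod≡ [] [] [] = ≡.refl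
    ι-Pointwise⇒mod≡ (u ∷ us) (v ∷ vs) (ιu≈ιv ∷ rest) =
      ≡.cong₂ _∷_ (ι-injective-mod u v ιu≈ιv) (ι-Pointwise⇒mod≡ us vs rest)

    -- Otherwise y, ι 0, …, ι (p ∸ 1) would be p + 1 distinct roots of xᵖ − x.
    ^p-fixed⇒¬¬ι : ∀ {y} → y ^ p ≈ y → ¬ ¬ ∃ λ (b : Fin p) → ι (toℕ b) ≈ y
    ^p-fixed⇒¬¬ι {y} yᵖ≈y ∄b =
      ^-fixed-points-bound isField p (ℕ.nonTrivial⇒n>1 p {{prime⇒nonTrivial isPrime}}) ρ ρ-injective fixed
      where
      ρ : Fin (suc p) → Carrier
      ρ zero = y
      ρ (suc b) = ι (toℕ b)
      ρ-injective : Injective _≡_ _≈_ ρ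
      ρ-injective {zero} {zero} _ = ≡.refl
      ρ-injective {zero} {suc c} y≈c = contradiction (c , sym y≈c) ∄b
      ρ-injective {suc b} {zero} b≈y = contradiction (b , b≈y) ∄b
      ρ-injective {suc b} {suc c} b≈c = ≡.cong suc (Fin.toℕ-injective (ι-injective-< (Fin.toℕ<n b) (Fin.toℕ<n c) b≈c))
      fixed : ∀ i → ρ i ^ p ≈ ρ i
      fixed zero = yᵖ≈y
      fixed (suc b) = ι^p≈ι isPrime char (toℕ b)

  module _ (isField : IsField K) (alg : IsAlgClosed K) {p} (isPrime : Prime p) (char : HasChar K p) where

    private instance
      p≢0 : NonZero p
      p≢0 = prime⇒nonZero isPrime

    -- A root of 1 + x + ⋯ + x^(m−1); it is not 1 since that polynomial takes the value m at 1.
    nontrivialRoot : ∀ {m} → 1 < m → ¬ p ∣ m → ∃ λ ζ → ζ ^ m ≈ 1# × ¬ ζ ≈ 1#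
    nontrivialRoot {suc zero} (s≤s ())
    nontrivialRoot {suc (suc k)} _ p∤m with alg 1# (List.replicate k 1#)
    ... | ζ , G[ζ]≈0 = ζ , ζᵐ≈1 , ζ≉1
      where
      ζᵐ≈1 : ζ ^ suc (suc k) ≈ 1#
      ζᵐ≈1 = x∙y⁻¹≈ε⇒x≈y _ _ (trans (sym (geometric-sum (suc k) ζ)) (trans (*-congˡ G[ζ]≈0) (zeroʳ _)))
      ζ≉1 : ¬ ζ ≈ 1#
      ζ≉1 ζ≈1 = ι≉0 isField isPrime char p∤m
        (trans (sym (geometric-sum-at-1 (suc k))) (trans (evalMonic-congʳ (List.replicate (suc k) 1#) (sym ζ≈1)) G[ζ]≈0))

    certificate⇒InW : ∀ {l m} .{{_ : NonZero l}} (as : Vec ℕ l) → Certificate p m as → ∀ n →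
                      l ℕ.* (p ∸ 1) ≤ n → InW K m n
    certificate⇒InW {m = m} as@(a₀ ∷ as′) (p∤Σ , reduces-to-1) with alg (ι a₀) (Vec.toList (Vec.map ι as′))
    ... | ζ , as[ζ]≈0 =
      relation⇒InW-beyond isPrime char {m = m} {ζ} (as ∷ʳ 1) ζᵐ≈1 (trans (eval-∷ʳ1 as ζ) monic[ζ]≈0) p∤Σ
      where
      monic[ζ]≈0 : monic (Vec.map ι as) ζ ≈ 0#
      monic[ζ]≈0 = trans (sym (evalMonic≈monic (Vec.map ι as) ζ)) as[ζ]≈0
      ζᵐ≈1 : ζ ^ m ≈ 1#
      ζᵐ≈1 = Divides-xᵐ-1⇒^≈1 isPrime char {m = m} as monic[ζ]≈0 reduces-to-1

  module FrobeniusOrbit (isField : IsField K) (alg : IsAlgClosed K) {p} (isPrime : Prime p) (char : HasChar K p)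
                        {m l} .{{_ : NonZero l}} (p⊥m : Coprime p m) (m∣pˡ-1 : m ∣ p ℕ.^ l ∸ 1)
                        (minimal : ∀ k → 0 < k → k < l → Coprime (p ℕ.^ k ∸ 1) m) (1<m : 1 < m) where

    private instance
      p≢0 : NonZero p
      p≢0 = prime⇒nonZero isPrime
      m≢0 : NonZero m
      m≢0 = ℕ.>-nonZero (ℕ.<-trans ℕ.z<s 1<m)

    p∤m : ¬ p ∣ m
    p∤m p∣m = ℕ.<⇒≢ (ℕ.nonTrivial⇒n>1 p {{prime⇒nonTrivial isPrime}}) (≡.sym (p⊥m (∣-refl , p∣m)))

    ζ : Carrier
    ζ = proj₁ (nontrivialRoot isField alg isPrime char 1<m p∤m)

    ζᵐ≈1 : ζ ^ m ≈ 1#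
    ζᵐ≈1 = proj₁ (proj₂ (nontrivialRoot isField alg isPrime char 1<m p∤m))

    ζ≉1 : ¬ ζ ≈ 1#
    ζ≉1 = proj₂ (proj₂ (nontrivialRoot isField alg isPrime char 1<m p∤m))

    orbit : ℕ → Carrier
    orbit k = ζ ^ (p ℕ.^ k)

    orbit-root : ∀ k → orbit k ^ m ≈ 1#
    orbit-root k = root-^ {m = m} (p ℕ.^ k) ζᵐ≈1

    ^pˡ≈id : ∀ {y} → y ^ m ≈ 1# → y ^ (p ℕ.^ l) ≈ y
    ^pˡ≈id {y} yᵐ≈1 = begin
      y ^ (p ℕ.^ l)              ≡⟨ ≡.cong (y ^_) pˡ≡1+qm ⟩
      y * y ^ (q ℕ.* m)          ≈⟨ *-congˡ (^-multiple≈1 q yᵐ≈1) ⟩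
      y * 1#                     ≈⟨ *-identityʳ y ⟩
      y                          ∎
      where
      open _∣_ m∣pˡ-1 renaming (quotient to q)
      pˡ≡1+qm : p ℕ.^ l ≡ 1 ℕ.+ q ℕ.* m
      pˡ≡1+qm = ≡.trans (≡.sym (ℕ.m+[n∸m]≡n (ℕ.m^n>0 p l))) (≡.cong (1 ℕ.+_) equality)

    ^p^[ql]≈id : ∀ {y} → y ^ m ≈ 1# → ∀ q → y ^ (p ℕ.^ (q ℕ.* l)) ≈ y
    ^p^[ql]≈id {y} yᵐ≈1 zero = *-identityʳ y
    ^p^[ql]≈id {y} yᵐ≈1 (suc q) = begin
      y ^ (p ℕ.^ (l ℕ.+ q ℕ.* l))                ≡⟨ ≡.cong (y ^_) (ℕ.^-distribˡ-+-* p l (q ℕ.* l)) ⟩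
      y ^ (p ℕ.^ l ℕ.* p ℕ.^ (q ℕ.* l))          ≈⟨ ^-assocʳ y (p ℕ.^ l) (p ℕ.^ (q ℕ.* l)) ⟨
      (y ^ (p ℕ.^ l)) ^ (p ℕ.^ (q ℕ.* l))        ≈⟨ ^-congˡ (p ℕ.^ (q ℕ.* l)) (^pˡ≈id yᵐ≈1) ⟩
      y ^ (p ℕ.^ (q ℕ.* l))                      ≈⟨ ^p^[ql]≈id yᵐ≈1 q ⟩
      y                                          ∎

    orbit-+ : ∀ i j → orbit (i ℕ.+ j) ≈ orbit i ^ (p ℕ.^ j)
    orbit-+ i j = trans (reflexive (≡.cong (ζ ^_) (ℕ.^-distribˡ-+-* p i j))) (sym (^-assocʳ ζ (p ℕ.^ i) (p ℕ.^ j)))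

    orbit-suc : ∀ k → orbit k ^ p ≈ orbit (suc k)
    orbit-suc k = trans (^-assocʳ ζ (p ℕ.^ k) p) (reflexive (≡.cong (ζ ^_) (ℕ.*-comm (p ℕ.^ k) p)))

    orbit-mod : ∀ k → orbit k ≈ orbit (k % l)
    orbit-mod k = begin
      orbit k                                   ≡⟨ ≡.cong orbit (m≡m%n+[m/n]*n k l) ⟩
      orbit (k % l ℕ.+ k / l ℕ.* l)             ≈⟨ orbit-+ (k % l) _ ⟩
      orbit (k % l) ^ (p ℕ.^ (k / l ℕ.* l))     ≈⟨ ^p^[ql]≈id (orbit-root (k % l)) (k / l) ⟩
      orbit (k % l)                             ∎

    orbit≉1 : ∀ k → ¬ orbit k ≈ 1#
    orbit≉1 zero orbit₀≈1 = ζ≉1 (trans (sym (*-identityʳ ζ)) orbit₀≈1)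
    orbit≉1 (suc k) orbitₖ₊₁≈1 = orbit≉1 k (^≈1-coprime⇒≈1 p⊥m (trans (orbit-suc k) orbitₖ₊₁≈1) (orbit-root k))

    orbit-distinct : ∀ {i j} → i < j → j ∸ i < l → ¬ orbit i ≈ orbit j
    orbit-distinct {i} {j} i<j j-i<l orbitᵢ≈orbitⱼ =
      orbit≉1 i (^≈1-coprime⇒≈1 (minimal d (ℕ.m<n⇒0<n∸m i<j) j-i<l) yᵗ≈1 (orbit-root i))
      where
      d : ℕ
      d = j ∸ i
      y : Carrier
      y = orbit i
      t : ℕ
      t = p ℕ.^ d ∸ 1
      y*yᵗ≈y*1 : y * y ^ t ≈ y * 1#
      y*yᵗ≈y*1 = begin
        y ^ suc t         ≡⟨ ≡.cong (y ^_) (ℕ.m+[n∸m]≡n (ℕ.m^n>0 p d)) ⟩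
        y ^ (p ℕ.^ d)     ≈⟨ orbit-+ i d ⟨
        orbit (i ℕ.+ d)   ≡⟨ ≡.cong orbit (ℕ.m+[n∸m]≡n (ℕ.<⇒≤ i<j)) ⟩
        orbit j           ≈⟨ orbitᵢ≈orbitⱼ ⟨
        y                 ≈⟨ *-identityʳ y ⟨
        y * 1#            ∎
      yᵗ≈1 : y ^ t ≈ 1#
      yᵗ≈1 = *-cancelˡ isField (^≈1⇒≉0 isField m (orbit-root i)) y*yᵗ≈y*1

    orbitFrom : ℕ → Fin l → Carrier
    orbitFrom s i = orbit (s ℕ.+ toℕ i)

    private
      orbitFrom-gap : ∀ s (i j : Fin l) → (s ℕ.+ toℕ j) ∸ (s ℕ.+ toℕ i) < l
      orbitFrom-gap s i j = ≡.subst (_< l) (≡.sym (ℕ.[m+n]∸[m+o]≡n∸o s (toℕ j) (toℕ i)))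
                                    (ℕ.≤-<-trans (ℕ.m∸n≤m (toℕ j) (toℕ i)) (Fin.toℕ<n j))

    orbitFrom-injective : ∀ s → Injective _≡_ _≈_ (orbitFrom s)
    orbitFrom-injective s {i} {j} orbitᵢ≈orbitⱼ with ℕ.<-cmp (toℕ i) (toℕ j)
    ... | tri< i<j _ _ = contradiction orbitᵢ≈orbitⱼ (orbit-distinct (ℕ.+-monoʳ-< s i<j) (orbitFrom-gap s i j))
    ... | tri≈ _ i≡j _ = Fin.toℕ-injective i≡j
    ... | tri> _ _ j<i = contradiction (sym orbitᵢ≈orbitⱼ) (orbit-distinct (ℕ.+-monoʳ-< s j<i) (orbitFrom-gap s j i))

    orbitPolynomial : Vec Carrier l
    orbitPolynomial = linearProduct (orbitFrom 0)

    orbitPolynomial-root : ∀ k → monic orbitPolynomial (orbit k) ≈ 0#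
    orbitPolynomial-root k = trans (monic-congʳ orbitPolynomial orbit[k]≈orbitFrom) (linearProduct-root (orbitFrom 0) i)
      where
      i : Fin l
      i = Fin.fromℕ< (m%n<n k l)
      orbit[k]≈orbitFrom : orbit k ≈ orbitFrom 0 i
      orbit[k]≈orbitFrom = trans (orbit-mod k) (reflexive (≡.cong orbit (≡.sym (Fin.toℕ-fromℕ< (m%n<n k l)))))

    -- Frobenius shifts the orbit by one step, and both polynomials vanish on the shifted window.
    orbitPolynomial-^p : Pointwise _≈_ (Vec.map (_^ p) orbitPolynomial) orbitPolynomial
    orbitPolynomial-^p = agree⇒≈ isField _ _ (orbitFrom 1) (orbitFrom-injective 1) λ i →
      +-cancelʳ (orbitFrom 1 i ^ l) _ _ (begin
        monic (Vec.map (_^ p) orbitPolynomial) (orbitFrom 1 i)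
          ≈⟨ monic-congʳ (Vec.map (_^ p) orbitPolynomial) (orbit-suc (toℕ i)) ⟨
        monic (Vec.map (_^ p) orbitPolynomial) (orbit (toℕ i) ^ p)
          ≈⟨ monic-^p isPrime char orbitPolynomial (orbit (toℕ i)) ⟩
        monic orbitPolynomial (orbit (toℕ i)) ^ p
          ≈⟨ ^-congˡ p (orbitPolynomial-root (toℕ i)) ⟩
        0# ^ p
          ≈⟨ 0^n≈0 p ⟩
        0#
          ≈⟨ orbitPolynomial-root (suc (toℕ i)) ⟨
        monic orbitPolynomial (orbitFrom 1 i)
          ∎)

    orbitPolynomial-at-1 : ¬ monic orbitPolynomial 1# ≈ 0#
    orbitPolynomial-at-1 = linearProduct-≉0 isField (orbitFrom 0) (λ i 1≈orbitᵢ → orbit≉1 (toℕ i) (sym 1≈orbitᵢ))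

    orbitPolynomial-over-𝔽ₚ : ¬ ¬ ∃ λ (a : Vec (Fin p) l) →
                              Pointwise (λ b c → ι (toℕ b) ≈ c) a orbitPolynomial
    orbitPolynomial-over-𝔽ₚ = ¬¬-Pointwise orbitPolynomial
      (All.map (^p-fixed⇒¬¬ι isField isPrime char) (Pointwise-map⇒All (_^ p) orbitPolynomial orbitPolynomial-^p))

    certificate-holds : ∀ (a : Vec (Fin p) l) → Pointwise (λ b c → ι (toℕ b) ≈ c) a orbitPolynomial →
                        Certificate p m (Vec.map toℕ a)
    certificate-holds a a≈f = p∤Σ , reduces-to-1
      where
      â : Vec ℕ l
      â = Vec.map toℕ a
      monic-â : ∀ x → monic (Vec.map ι â) x ≈ monic orbitPolynomial x
      monic-â x = +-congʳ (eval-cong x (Pointwise-mapˡ ι (Pointwise-mapˡ toℕ a≈f)))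
      p∤Σ : ¬ p ∣ Vec.sum (â ∷ʳ 1)
      p∤Σ p∣Σ = orbitPolynomial-at-1 (begin
        monic orbitPolynomial 1#             ≈⟨ monic-â 1# ⟨
        monic (Vec.map ι â) 1#               ≈⟨ eval-∷ʳ1 â 1# ⟨
        eval (Vec.map ι (â ∷ʳ 1)) 1#          ≈⟨ eval-at-1 (â ∷ʳ 1) ⟩
        ι (Vec.sum (â ∷ʳ 1))                 ≈⟨ ι-∣⇒≈0 isPrime char p∣Σ ⟩
        0#                                   ∎)
      â[orbit]≈0 : ∀ i → monic (Vec.map ι â) (orbitFrom 0 i) ≈ 0#
      â[orbit]≈0 i = trans (monic-â (orbitFrom 0 i)) (orbitPolynomial-root (toℕ i))
      reduces-to-1 : Divides-xᵐ-1 p â m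
      reduces-to-1 =
        ι-Pointwise⇒mod≡ isField isPrime char _ _ (agree⇒≈ isField _ _ (orbitFrom 0) (orbitFrom-injective 0) λ i → begin
          eval (Vec.map ι (xPowMod p â m)) (orbitFrom 0 i)   ≈⟨ eval-xPowMod isPrime char â (â[orbit]≈0 i) m ⟩
          orbitFrom 0 i ^ m                                  ≈⟨ orbit-root (toℕ i) ⟩
          1#                                                 ≈⟨ eval-xPowMod isPrime char â (â[orbit]≈0 i) 0 ⟨
          eval (Vec.map ι (xPowMod p â 0)) (orbitFrom 0 i)   ∎)

    certificate : ∃ λ (a : Vec (Fin p) l) → Certificate p m (Vec.map toℕ a)
    certificate = Dec.decidable-stable (∃-Vec? l (λ a → certificate? p m (Vec.map toℕ a)))
      (λ ∄a → orbitPolynomial-over-𝔽ₚ (λ (a , a≈f) → ∄a (a , certificate-holds a a≈f)))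

    InW-beyond : ∀ n → l ℕ.* (p ∸ 1) ≤ n → InW K m n
    InW-beyond = certificate⇒InW isField alg isPrime char {m = m} (Vec.map toℕ (proj₁ certificate)) (proj₂ certificate)

open import Data.Nat using (_*_; _^_)

corollary5p5 : ∀ {c ℓ : Level} (K : CommutativeRing c ℓ)
    → IsField K → IsAlgClosed K
    → (p m : ℕ) → Prime p → HasChar K p
    → 3 ≤ m → gcd p m ≡ 1 → gcd (p ∸ 1) m ≡ 1
    → (l : ℕ) → IsLeastOrderIndex p m l
    → ((n : ℕ) → l * (p ∸ 1) ≤ n → InW K (gcd (p ^ l ∸ 1) m) n)
      × ((n : ℕ) → InW K (gcd (p ^ l ∸ 1) m) n → InW K m n)
corollary5p5 K isField alg p m isPrime char 3≤m p⊥m _ l least@(1≤l , 1<m′ , _) =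
  InW-beyond , λ _ → InW-∣ K m′∣m
  where
  instance
    l≢0 : NonZero l
    l≢0 = ℕ.>-nonZero 1≤l
    m≢0 : NonZero m
    m≢0 = ℕ.>-nonZero (ℕ.<-trans ℕ.z<s (ℕ.<-trans (s≤s (s≤s z≤n)) 3≤m))
  m′ : ℕ
  m′ = gcd (p ^ l ∸ 1) m
  m′∣m : m′ ∣ m
  m′∣m = gcd[m,n]∣n (p ^ l ∸ 1) m
  minimal : ∀ k → 0 < k → k < l → Coprime (p ^ k ∸ 1) m′
  minimal k 0<k k<l = Coprime-∣ʳ (IsLeastOrderIndex⇒coprime least k 0<k k<l) m′∣m
  open FrobeniusOrbit K isField alg isPrime char
         (Coprime-∣ʳ (gcd≡1⇒coprime p⊥m) m′∣m) (gcd[m,n]∣m (p ^ l ∸ 1) m) minimal 1<m′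
    using (InW-beyond)
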